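{- Let $s, t$ be positive integers and let $a_1,\dots,a_{2s}, d_1,\dots,d_{t-1}$ be real numbers with $a_1 + a_{s+1} = a_2 + a_{s+2} = \cdots = a_s + a_{2s}$. Let \[ A' = \{ a_i + \varepsilon_1 d_1 + \cdots + \varepsilon_{t-1} d_{t-1} : 1 \leq i \leq 2s,\ \varepsilon_1,\dots,\varepsilon_{t-1} \in \{0,1\} \}. \] Then $|A' - A'| \leq 3^{t-1} s^2 + \frac{3^{t-1} - 1}{2}$.
   Context: For finite $A \subseteq \mathbb{R}$, $A - A = \{|a-b| : a,b \in A,\ a \neq b\}$ (positive differences only). -}

module Defs where

open import Algebra.Bundles using (AbelianGroup)
open import Data.Nat using (ℕ; zero; suc; _≤_)
open import Data.Fin using (Fin; zero; suc)
open import Data.Bool using (Bool; if_then_else_)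
open import Data.List using (List; length)
open import Data.List.Relation.Unary.Any using (Any)
open import Data.Product using (Σ; _×_)
open import Data.Sum using (_⊎_)
open import Relation.Nullary using (¬_)
open import Function using (_∘_)

-- The ambient group: any abelian group G (written multiplicatively by the
-- library: _∙_, ε, _⁻¹).  (ℝ,+) is the instance of interest.
module _ {c ℓ} (G : AbelianGroup c ℓ) where
  open AbelianGroup G

  sumF : (n : ℕ) → (Fin n → Carrier) → Carrier
  sumF zero    f = ε
  sumF (suc n) f = f zero ∙ sumF n (f ∘ suc)

  shift : {n : ℕ} → (Fin n → Carrier) → (Fin n → Bool) → Carrier
  shift {n} d e = sumF n (λ k → if e k then d k else ε)

  Aelem : {m n : ℕ} → (Fin m → Carrier) → (Fin n → Carrier) → Fin m → (Fin n → Bool) → Carrier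
  Aelem a d i e = a i ∙ shift d e

  diff : Carrier → Carrier → Carrier
  diff x y = x ∙ (y ⁻¹)

  SameAbs : Carrier → Carrier → Set ℓ
  SameAbs x y = (x ≈ y) ⊎ (x ≈ (y ⁻¹))

  -- |A' - A'| ≤ N, where A' - A' = { |x - y| : x, y ∈ A', x ≠ y }:
  -- there is a list of at most N elements z such that every positive
  -- difference |x - y| equals some |z|.
  DiffCard≤ : {m n : ℕ} → (Fin m → Carrier) → (Fin n → Carrier) → ℕ → Set (c Agda.Primitive.⊔ ℓ)
  DiffCard≤ a d N =
    Σ (List Carrier) λ S → (length S ≤ N) ×
      ((i j : _) (e e' : _) → ¬ (Aelem a d i e ≈ Aelem a d j e') →
        Any (SameAbs (diff (Aelem a d i e) (Aelem a d j e'))) S)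

-- Write c for the common value a_p + a_{s+p}, A_p = a_p and B_p = a_{s+p} = c - A_p.
-- Every difference of two a's is, up to sign, 0, A_p - A_q with p > q, or
-- A_p - B_q = A_p + A_q - c with p ≤ q: at most s² values.  Adding one more
-- shift d, a difference of A' either keeps an old difference D or becomes
-- D ± d, so it is ±(w + d) for w ∈ {0} ∪ ±(old set): a set of N
-- differences grows to at most 3N + 1, which solves to
-- 3^(t-1) s² + (3^(t-1) - 1)/2.
module Submission where

open import Defs
open import Algebra.Bundles using (AbelianGroup)
open import Data.Nat using (ℕ; _≤_; _+_; _*_; _∸_; _^_; _/_)
open import Data.Fin using (Fin; _↑ˡ_; _↑ʳ_)

open import Data.Nat using (zero; suc)
open import Data.Nat.Properties using (m+n∸n≡m; ≤-reflexive; ≰⇒>; <⇒≤; <⇒≱)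
open import Data.Nat.DivMod using (m*n/n≡m)
open import Data.Nat.Tactic.RingSolver using (solve-∀)
import Data.Fin as Fin
open import Data.Fin using (_≤?_; _<_; splitAt; remQuot; combine)
open import Data.Fin.Properties using (<-cmp; join-splitAt; remQuot-combine)
open import Data.Bool using (Bool; true; false; if_then_else_)
open import Data.List using (List; _∷_; _++_; map; length; tabulate)
open import Data.List.Properties using (length-++; length-map; length-tabulate)
open import Data.List.Relation.Unary.Any using (Any; here; there)
import Data.List.Relation.Unary.Any as Any
open import Data.List.Relation.Unary.Any.Properties using (++⁺ˡ; ++⁺ʳ; map⁺; tabulate⁺)
open import Data.Product using (Σ-syntax; _×_; _,_; uncurry)
open import Data.Sum using (_⊎_; inj₁; inj₂; [_,_]′; map₂)
open import Data.Empty using (⊥-elim)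
open import Relation.Nullary using (yes; no; ¬_)
open import Relation.Binary.Definitions using (tri<; tri≈; tri>)
open import Relation.Binary.PropositionalEquality as P using (_≡_)
open import Function using (_∘_)
open import Level using (_⊔_)

repunit₃ : ℕ → ℕ
repunit₃ zero    = 0
repunit₃ (suc n) = suc (3 * repunit₃ n)

repunit₃*2+1≡3^n : ∀ n → repunit₃ n * 2 + 1 ≡ 3 ^ n
repunit₃*2+1≡3^n zero    = P.refl
repunit₃*2+1≡3^n (suc n) = P.trans (step (repunit₃ n)) (P.cong (3 *_) (repunit₃*2+1≡3^n n))
  where
  step : ∀ r → suc (3 * r) * 2 + 1 ≡ 3 * (r * 2 + 1)
  step = solve-∀

[3^n∸1]/2≡repunit₃ : ∀ n → (3 ^ n ∸ 1) / 2 ≡ repunit₃ n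
[3^n∸1]/2≡repunit₃ n = begin
  (3 ^ n ∸ 1) / 2                ≡⟨ P.cong (λ k → (k ∸ 1) / 2) (repunit₃*2+1≡3^n n) ⟨
  (repunit₃ n * 2 + 1 ∸ 1) / 2   ≡⟨ P.cong (_/ 2) (m+n∸n≡m (repunit₃ n * 2) 1) ⟩
  repunit₃ n * 2 / 2             ≡⟨ m*n/n≡m (repunit₃ n) 2 ⟩
  repunit₃ n                     ∎
  where open P.≡-Reasoning

module _ {c ℓ} (G : AbelianGroup c ℓ) where
  open AbelianGroup G
  open import Algebra.Properties.AbelianGroup G
  open import Algebra.Properties.CommutativeSemigroup commutativeSemigroup using (interchange)
  open import Relation.Binary.Reasoning.Setoid setoid

  -‿interchange : ∀ x u y v → (x ∙ u) - (y ∙ v) ≈ (x - y) ∙ (u - v)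
  -‿interchange x u y v = begin
    (x ∙ u) ∙ (y ∙ v) ⁻¹      ≈⟨ ∙-congˡ (⁻¹-∙-comm y v) ⟨
    (x ∙ u) ∙ (y ⁻¹ ∙ v ⁻¹)   ≈⟨ interchange x u (y ⁻¹) (v ⁻¹) ⟩
    (x - y) ∙ (u - v)         ∎

  x∙v≈u∙y⇒x-y≈u-v : ∀ {x y u v} → x ∙ v ≈ u ∙ y → x - y ≈ u - v
  x∙v≈u∙y⇒x-y≈u-v {x} {y} {u} {v} x∙v≈u∙y = begin
    x - y                     ≈⟨ identityʳ (x - y) ⟨
    (x - y) ∙ ε               ≈⟨ ∙-congˡ (inverseʳ v) ⟨
    (x - y) ∙ (v - v)         ≈⟨ -‿interchange x v y v ⟨
    (x ∙ v) - (y ∙ v)         ≈⟨ //-cong₂ x∙v≈u∙y (comm y v) ⟩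
    (u ∙ y) - (v ∙ y)         ≈⟨ -‿interchange u y v y ⟩
    (u - v) ∙ (y - y)         ≈⟨ ∙-congˡ (inverseʳ y) ⟩
    (u - v) ∙ ε               ≈⟨ identityʳ (u - v) ⟩
    u - v                     ∎

  Covers : List Carrier → Carrier → Set (c ⊔ ℓ)
  Covers S z = z ≈ ε ⊎ Any (SameAbs G z) S

  Covers-resp-≈ : ∀ {S z w} → z ≈ w → Covers S w → Covers S z
  Covers-resp-≈ z≈w (inj₁ w≈ε) = inj₁ (trans z≈w w≈ε)
  Covers-resp-≈ z≈w (inj₂ w∈±S) = inj₂ (Any.map (map-SameAbs z≈w) w∈±S)
    where
    map-SameAbs : ∀ {z w v} → z ≈ w → SameAbs G w v → SameAbs G z v
    map-SameAbs z≈w (inj₁ w≈v)   = inj₁ (trans z≈w w≈v)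
    map-SameAbs z≈w (inj₂ w≈v⁻¹) = inj₂ (trans z≈w w≈v⁻¹)

  Covers-⁻¹ : ∀ {S z} → Covers S z → Covers S (z ⁻¹)
  Covers-⁻¹ (inj₁ z≈ε)  = inj₁ (trans (⁻¹-cong z≈ε) ε⁻¹≈ε)
  Covers-⁻¹ (inj₂ z∈±S) = inj₂ (Any.map negate z∈±S)
    where
    negate : ∀ {z v} → SameAbs G z v → SameAbs G (z ⁻¹) v
    negate (inj₁ z≈v)   = inj₂ (⁻¹-cong z≈v)
    negate (inj₂ z≈v⁻¹) = inj₁ (trans (⁻¹-cong z≈v⁻¹) (⁻¹-involutive _))

  Covers-++⁺ˡ : ∀ {S z} T → Covers S z → Covers (S ++ T) z
  Covers-++⁺ˡ T = map₂ ++⁺ˡ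

  ±_ : List Carrier → List Carrier
  ± S = ε ∷ S ++ map _⁻¹ S

  Covers⇒∈± : ∀ {S z} → Covers S z → Any (z ≈_) (± S)
  Covers⇒∈± (inj₁ z≈ε)          = here z≈ε
  Covers⇒∈± {S} (inj₂ z∈±S) = there ([ ++⁺ˡ , ++⁺ʳ S ∘ map⁺ ]′ (split z∈±S))
    where
    split : ∀ {z S} → Any (SameAbs G z) S → Any (z ≈_) S ⊎ Any (λ w → z ≈ w ⁻¹) S
    split (here (inj₁ z≈w))    = inj₁ (here z≈w)
    split (here (inj₂ z≈w⁻¹))  = inj₂ (here z≈w⁻¹)
    split (there z∈±S) with split z∈±S
    ... | inj₁ p = inj₁ (there p)
    ... | inj₂ q = inj₂ (there q)

  extend : Carrier → List Carrier → List Carrier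
  extend d S = S ++ map (_∙ d) (± S)

  length-extend : ∀ d S → length (extend d S) ≡ suc (3 * length S)
  length-extend d S
    rewrite length-++ S {map (_∙ d) (± S)} | length-map (_∙ d) (± S)
          | length-++ S {map _⁻¹ S}       | length-map _⁻¹ S
    = arith (length S)
    where
    arith : ∀ l → l + suc (l + l) ≡ suc (3 * l)
    arith = solve-∀

  Covers-extend-∙ : ∀ {S z} d → Covers S z → Covers (extend d S) (z ∙ d)
  Covers-extend-∙ {S} d cov =
    inj₂ (++⁺ʳ S (map⁺ (Any.map (inj₁ ∘ ∙-congʳ) (Covers⇒∈± cov))))

  -- z - d = -((-z) + d), so the negative shift reduces to the positive one.
  Covers-extend-- : ∀ {S z} d → Covers S z → Covers (extend d S) (z - d)
  Covers-extend-- {z = z} d cov =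
    Covers-resp-≈ z-d≈-[-z+d] (Covers-⁻¹ (Covers-extend-∙ d (Covers-⁻¹ cov)))
    where
    z-d≈-[-z+d] : z - d ≈ (z ⁻¹ ∙ d) ⁻¹
    z-d≈-[-z+d] = begin
      z ∙ d ⁻¹           ≈⟨ ∙-congʳ (⁻¹-involutive z) ⟨
      z ⁻¹ ⁻¹ ∙ d ⁻¹     ≈⟨ ⁻¹-∙-comm (z ⁻¹) d ⟩
      (z ⁻¹ ∙ d) ⁻¹      ∎

  Covers-extend : ∀ {S z} d (b b' : Bool) → Covers S z →
    Covers (extend d S) (z ∙ ((if b then d else ε) - (if b' then d else ε)))
  Covers-extend d true true cov =
    Covers-resp-≈ (trans (∙-congˡ (inverseʳ d)) (identityʳ _)) (Covers-++⁺ˡ _ cov)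
  Covers-extend d false false cov =
    Covers-resp-≈ (trans (∙-congˡ (inverseʳ ε)) (identityʳ _)) (Covers-++⁺ˡ _ cov)
  Covers-extend d true false cov =
    Covers-resp-≈ (∙-congˡ (trans (∙-congˡ ε⁻¹≈ε) (identityʳ d))) (Covers-extend-∙ d cov)
  Covers-extend d false true cov =
    Covers-resp-≈ (∙-congˡ (identityˡ (d ⁻¹))) (Covers-extend-- d cov)

  module _ {m} (a : Fin m → Carrier) where

    DiffsCovered : ∀ {n} → (Fin n → Carrier) → List Carrier → Set (c ⊔ ℓ)
    DiffsCovered d S = ∀ i j e e' → Covers S (Aelem G a d i e - Aelem G a d j e')

    Aelem-suc : ∀ {n} (d : Fin (suc n) → Carrier) i e →
      Aelem G a d i e ≈ Aelem G a (d ∘ Fin.suc) i (e ∘ Fin.suc) ∙ (if e Fin.zero then d Fin.zero else ε)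
    Aelem-suc d i e = trans (∙-congˡ (comm _ _)) (sym (assoc _ _ _))

    shifts-covered : (S₀ : List Carrier) → (∀ i j → Covers S₀ (a i - a j)) →
      ∀ n (d : Fin n → Carrier) →
      Σ[ S ∈ List Carrier ] (length S ≡ 3 ^ n * length S₀ + repunit₃ n) × DiffsCovered d S
    shifts-covered S₀ cov₀ zero d =
      S₀ , solve₀ (length S₀) , λ i j _ _ → Covers-resp-≈ (//-cong₂ (identityʳ (a i)) (identityʳ (a j))) (cov₀ i j)
      where
      solve₀ : ∀ l → l ≡ 1 * l + 0
      solve₀ = solve-∀
    shifts-covered S₀ cov₀ (suc n) d with shifts-covered S₀ cov₀ n (d ∘ Fin.suc)
    ... | S , |S| , cov = extend (d Fin.zero) S , |extend| , cov'
      where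
      |extend| : length (extend (d Fin.zero) S) ≡ 3 ^ suc n * length S₀ + repunit₃ (suc n)
      |extend| = P.trans (length-extend (d Fin.zero) S)
        (P.trans (P.cong (suc ∘ (3 *_)) |S|) (arith (3 ^ n) (length S₀) (repunit₃ n)))
        where
        arith : ∀ p l r → suc (3 * (p * l + r)) ≡ (3 * p) * l + suc (3 * r)
        arith = solve-∀
      cov' : DiffsCovered d (extend (d Fin.zero) S)
      cov' i j e e' =
        Covers-resp-≈
          (trans (//-cong₂ (Aelem-suc d i e) (Aelem-suc d j e')) (-‿interchange _ _ _ _))
          (Covers-extend (d Fin.zero) (e Fin.zero) (e' Fin.zero) (cov i j (e ∘ Fin.suc) (e' ∘ Fin.suc)))

  module _ {s} (A B : Fin s → Carrier) (balanced : ∀ p q → A p ∙ B p ≈ A q ∙ B q) where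

    pairDiff : Fin s → Fin s → Carrier
    pairDiff p q with p ≤? q
    ... | yes _ = A p - B q
    ... | no _  = A p - A q

    pairDiff-≤ : ∀ {p q} → p Fin.≤ q → pairDiff p q ≈ A p - B q
    pairDiff-≤ {p} {q} p≤q with p ≤? q
    ... | yes _  = refl
    ... | no p≰q = ⊥-elim (p≰q p≤q)

    pairDiff-> : ∀ {p q} → q < p → pairDiff p q ≈ A p - A q
    pairDiff-> {p} {q} q<p with p ≤? q
    ... | yes p≤q = ⊥-elim (<⇒≱ q<p p≤q)
    ... | no _    = refl

    pairDiffs : List Carrier
    pairDiffs = tabulate (uncurry pairDiff ∘ remQuot s)

    length-pairDiffs : length pairDiffs ≡ s * s
    length-pairDiffs = length-tabulate _

    pairDiff-covered : ∀ {z} p q → SameAbs G z (pairDiff p q) → Covers pairDiffs z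
    pairDiff-covered {z} p q z≈±pq = inj₂ (tabulate⁺ (combine p q)
      (P.subst (SameAbs G z) (P.cong (uncurry pairDiff) (P.sym (remQuot-combine p q))) z≈±pq))

    A-A-covered : ∀ p q → Covers pairDiffs (A p - A q)
    A-A-covered p q with <-cmp p q
    ... | tri< p<q _ _ = pairDiff-covered q p
                           (inj₂ (trans (sym (⁻¹-anti-homo‿- (A q) (A p))) (⁻¹-cong (sym (pairDiff-> p<q)))))
    ... | tri≈ _ P.refl _ = inj₁ (inverseʳ (A p))
    ... | tri> _ _ q<p = pairDiff-covered p q (inj₁ (sym (pairDiff-> q<p)))

    -- A_p - B_q is symmetric in p and q, as it equals A_p + A_q - c.
    A-B-covered : ∀ p q → Covers pairDiffs (A p - B q)
    A-B-covered p q with p ≤? q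
    ... | yes p≤q = pairDiff-covered p q (inj₁ (sym (pairDiff-≤ p≤q)))
    ... | no p≰q  = pairDiff-covered q p
                      (inj₁ (trans (x∙v≈u∙y⇒x-y≈u-v (balanced p q)) (sym (pairDiff-≤ (<⇒≤ (≰⇒> p≰q))))))

    B-B-covered : ∀ p q → Covers pairDiffs (B p - B q)
    B-B-covered p q =
      Covers-resp-≈ (x∙v≈u∙y⇒x-y≈u-v (trans (comm (B p) (A p)) (balanced p q))) (A-A-covered q p)

    B-A-covered : ∀ p q → Covers pairDiffs (B p - A q)
    B-A-covered p q = Covers-resp-≈ (sym (⁻¹-anti-homo‿- (A q) (B p))) (Covers-⁻¹ (A-B-covered q p))

  paired-covered : ∀ {s} (a : Fin (s + s) → Carrier)
    (balanced : ∀ p q → a (p ↑ˡ s) ∙ a (s ↑ʳ p) ≈ a (q ↑ˡ s) ∙ a (s ↑ʳ q)) →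
    ∀ i j → Covers (pairDiffs (λ p → a (p ↑ˡ s)) (λ p → a (s ↑ʳ p)) balanced) (a i - a j)
  paired-covered {s} a balanced i j =
    P.subst₂ (λ i j → Covers (pairDiffs A B balanced) (a i - a j))
      (join-splitAt s s i) (join-splitAt s s j)
      (ends-covered (splitAt s i) (splitAt s j))
    where
    A B : Fin s → Carrier
    A p = a (p ↑ˡ s)
    B p = a (s ↑ʳ p)
    ends-covered : ∀ x y → Covers (pairDiffs A B balanced) (a (Fin.join s s x) - a (Fin.join s s y))
    ends-covered (inj₁ p) (inj₁ q) = A-A-covered A B balanced p q
    ends-covered (inj₁ p) (inj₂ q) = A-B-covered A B balanced p q
    ends-covered (inj₂ p) (inj₁ q) = B-A-covered A B balanced p q
    ends-covered (inj₂ p) (inj₂ q) = B-B-covered A B balanced p q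

lemma4p3 : ∀ {c ℓ} (G : AbelianGroup c ℓ) (s t : ℕ) → 1 ≤ s → 1 ≤ t →
    (a : Fin (s + s) → AbelianGroup.Carrier G) →
    (d : Fin (t ∸ 1) → AbelianGroup.Carrier G) →
    ((i j : Fin s) → AbelianGroup._≈_ G
        (AbelianGroup._∙_ G (a (i ↑ˡ s)) (a (s ↑ʳ i)))
        (AbelianGroup._∙_ G (a (j ↑ˡ s)) (a (s ↑ʳ j)))) →
    DiffCard≤ G a d (3 ^ (t ∸ 1) * (s * s) + (3 ^ (t ∸ 1) ∸ 1) / 2)
lemma4p3 G s t _ _ a d balanced
  with shifts-covered G a (pairDiffs G _ _ balanced) (paired-covered G a balanced) (t ∸ 1) d
... | S , |S| , cov = S , ≤-reflexive |S|≡bound , nonzero-covered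
  where
  open AbelianGroup G
  open import Algebra.Properties.AbelianGroup G using (x∙y⁻¹≈ε⇒x≈y)
  n : ℕ
  n = t ∸ 1
  |S|≡bound : length S ≡ 3 ^ n * (s * s) + (3 ^ n ∸ 1) / 2
  |S|≡bound = P.trans |S| (P.cong₂ (λ l r → 3 ^ n * l + r)
    (length-pairDiffs G _ _ balanced) (P.sym ([3^n∸1]/2≡repunit₃ n)))
  nonzero-covered : ∀ i j e e' → ¬ (Aelem G a d i e ≈ Aelem G a d j e') →
    Any (SameAbs G (diff G (Aelem G a d i e) (Aelem G a d j e'))) S
  nonzero-covered i j e e' x≉y with cov i j e e'
  ... | inj₁ x-y≈ε = ⊥-elim (x≉y (x∙y⁻¹≈ε⇒x≈y _ _ x-y≈ε))
  ... | inj₂ x-y∈±S = x-y∈±S
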